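{- Let $\varphi$ be a CNF and $B$ an OBDD with $\varphi\unlhd B$. Let $p$ be an inner node of $B$ with $\mathsf{high}(p)\equiv\mathsf{low}(p)$, and let $B'$ be obtained from $B$ by eliminating $p$ ($B\rightarrow_p B'$). Then there is a CNF $\psi\in\mathsf{Res}(p,\varphi)$ such that $|\mathsf{Cls}(\psi)|\le|\mathsf{Path^f}(p)|/2$.
   Context: A literal is a variable or its negation, a clause a disjunction of literals, a CNF a conjunction of clauses; $\mathsf{Cls}(\varphi)$ is the set of clauses of $\varphi$. An OBDD is a directed acyclic graph with a unique root, in which every inner node $p$ is labelled by a variable $\mathsf{var}(p)$ and has a true-successor and a false-successor, every leaf is labelled $\mathsf{true}$ or $\mathsf{false}$, and there is a fixed total order $\prec$ of variables such that along every edge between inner nodes labelled $x$ then $y$ we have $x\prec y$. $\mathsf{high}(p)$, $\mathsf{low}(p)$ are the sub-OBDDs rooted at the true-/false-successor of $p$. Isomorphism $\equiv$: both are the same leaf, or roots have the same variable and high parts are isomorphic and low parts are isomorphic. Elimination: if $\mathsf{high}(p)\equiv\mathsf{low}(p)$, remove $p$ and redirect every link to $p$ to the root of $\mathsf{high}(p)$; write $B\rightarrow_p B'$ for the result. A path of $B$ is the sequence of literals $l_1\dots l_k$ read along a walk from the root to a leaf through inner nodes $p_1,\dots,p_k$, with $l_i=\mathsf{var}(p_i)$ if the walk goes to the true-successor of $p_i$ and $l_i=\lnot\mathsf{var}(p_i)$ otherwise. $\mathsf{Path^f}(B)$ is the set of paths ending at the $\mathsf{false}$ leaf, and $\mathsf{Path^f}(p)$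 is the set of those whose walk passes through the node $p$. For a path $\alpha$ (a conjunction of literals) and a clause $C$, $\alpha\not\models C$ means every assignment satisfying all literals of $\alpha$ falsifies $C$. $\varphi\unlhd B$ means: an assignment falsifies $\varphi$ iff it satisfies all literals of some $\alpha\in\mathsf{Path^f}(B)$; and for every $\alpha\in\mathsf{Path^f}(B)$ there is $C\in\mathsf{Cls}(\varphi)$ with $\alpha\not\models C$. Resolution: the resolvent of $l\vee C$ and $\lnot l\vee D$ (where $C,D$ contain no complementary pair of literals) is $C\vee D$. $\varphi\vdash_{\mathrm{res}}\psi$ means $\psi$ is the conjunction of the clauses $C_{m+1},\dots,C_{k'}$ of a sequence $C_1,\dots,C_{k'}$ in which $C_1,\dots,C_m$ are the clauses of $\varphi$ and each later clause is the resolvent of two earlier ones. For $B\rightarrow_p B'$, $\mathsf{Res}(p,\varphi)=\{\psi \text{ a CNF}\mid \varphi\vdash_{\mathrm{res}}\psi\text{ and }\varphi\wedge\psi\unlhd B'\}$. -}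

module Defs where

open import Data.Nat using (ℕ; _<_; _*_)
open import Data.Bool using (Bool; true; false; not; if_then_else_)
open import Data.Fin using (Fin; _≟_)
open import Data.List using (List; []; _∷_; _++_; [_]; length)
open import Data.List.Membership.Propositional using (_∈_)
open import Data.List.Relation.Unary.Unique.Propositional using (Unique)
open import Data.Product using (Σ; ∃; ∃-syntax; _×_; _,_)
open import Data.Sum using (_⊎_)
open import Relation.Nullary using (¬_; does)
open import Relation.Binary.PropositionalEquality using (_≡_)

record Literal : Set where
  constructor lit
  field
    sign : Bool   -- true: the variable itself, false: its negation
    var  : ℕ

open Literal public

compl : Literal → Literal
compl (lit s x) = lit (not s) x

-- A clause is a disjunction of literals, represented by a list; clauses
-- are identified up to having the same set of literals (see _≈C_).
Clause : Set
Clause = List Literal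

CNF : Set
CNF = List Clause

_≈C_ : Clause → Clause → Set
C ≈C D = (∀ l → l ∈ C → l ∈ D) × (∀ l → l ∈ D → l ∈ C)

Assignment : Set
Assignment = ℕ → Bool

SatLit : Assignment → Literal → Set
SatLit a (lit s x) = a x ≡ s

SatClause : Assignment → Clause → Set
SatClause a C = ∃[ l ] (l ∈ C × SatLit a l)

FalsifiesCNF : Assignment → CNF → Set
FalsifiesCNF a φ = ∃[ C ] (C ∈ φ × ¬ SatClause a C)

SatAll : Assignment → List Literal → Set
SatAll a α = ∀ l → l ∈ α → SatLit a l

_⊭_ : List Literal → Clause → Set
α ⊭ C = ∀ a → SatAll a α → ¬ SatClause a C

data Node (n : ℕ) : Set where
  leaf  : Bool → Node n
  -- inner x h l : labelled by variable x, true-successor h, false-successor l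
  inner : ℕ → Fin n → Fin n → Node n

record OBDD (n : ℕ) : Set where
  constructor obdd
  field
    node : Fin n → Node n
    root : Fin n

open OBDD public

-- The variable order ≺ is the order _<_ on ℕ: along every edge between
-- inner nodes labelled x then y we have x < y.  This also makes the graph
-- acyclic.
OrderedEdge : ∀ {n} → OBDD n → ℕ → Fin n → Set
OrderedEdge B x c = ∀ y h l → node B c ≡ inner y h l → x < y

data Reachable {n} (B : OBDD n) : Fin n → Set where
  rroot : Reachable B (root B)
  rhi   : ∀ {i x h l} → Reachable B i → node B i ≡ inner x h l → Reachable B h
  rlo   : ∀ {i x h l} → Reachable B i → node B i ≡ inner x h l → Reachable B l

-- well-formed OBDD: ordered edges, and the root is the unique root
-- (every node is reachable from it)
WellFormed : ∀ {n} → OBDD n → Set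
WellFormed {n} B =
  (∀ i x h l → node B i ≡ inner x h l → OrderedEdge B x h × OrderedEdge B x l)
  × (∀ i → Reachable B i)

data Iso {n} (B : OBDD n) : Fin n → Fin n → Set where
  isoLeaf  : ∀ {i j b} → node B i ≡ leaf b → node B j ≡ leaf b → Iso B i j
  isoInner : ∀ {i j x h l h' l'} → node B i ≡ inner x h l → node B j ≡ inner x h' l'
           → Iso B h h' → Iso B l l' → Iso B i j

-- Elimination of node p with high(p) = h: every link to p (including the
-- root pointer) is redirected to h.  Node p itself stays in the table but
-- is no longer reachable.
redirect : ∀ {n} → Fin n → Fin n → Fin n → Fin n
redirect p h j = if does (j ≟ p) then h else j

redirectNode : ∀ {n} → Fin n → Fin n → Node n → Node n
redirectNode p h (leaf b) = leaf b
redirectNode p h (inner x hi lo) = inner x (redirect p h hi) (redirect p h lo)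

eliminate : ∀ {n} → OBDD n → Fin n → Fin n → OBDD n
eliminate B p h = obdd (λ j → redirectNode p h (node B j)) (redirect p h (root B))

data FWalk {n} (B : OBDD n) : Fin n → List Literal → Set where
  fleaf : ∀ {i} → node B i ≡ leaf false → FWalk B i []
  fhi   : ∀ {i x h l α} → node B i ≡ inner x h l → FWalk B h α → FWalk B i (lit true x ∷ α)
  flo   : ∀ {i x h l α} → node B i ≡ inner x h l → FWalk B l α → FWalk B i (lit false x ∷ α)

Visits : ∀ {n} {B : OBDD n} {i α} → Fin n → FWalk B i α → Set
Visits p (fleaf {i} _) = i ≡ p
Visits p (fhi {i} _ w) = i ≡ p ⊎ Visits p w
Visits p (flo {i} _ w) = i ≡ p ⊎ Visits p w

PathF : ∀ {n} → OBDD n → List Literal → Set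
PathF B α = FWalk B (root B) α

PathFThrough : ∀ {n} → OBDD n → Fin n → List Literal → Set
PathFThrough B p α = Σ (FWalk B (root B) α) (Visits p)

HasCard : (List Literal → Set) → ℕ → Set
HasCard P N = ∃[ L ] (Unique L × (∀ α → (α ∈ L → P α) × (P α → α ∈ L)) × length L ≡ N)

_⊴_ : ∀ {n} → CNF → OBDD n → Set
φ ⊴ B = (∀ a → (FalsifiesCNF a φ → ∃[ α ] (PathF B α × SatAll a α))
             × (∃[ α ] (PathF B α × SatAll a α) → FalsifiesCNF a φ))
      × (∀ α → PathF B α → ∃[ C ] (C ∈ φ × α ⊭ C))

NoComplPair : Clause → Set
NoComplPair C = ∀ l → l ∈ C → ¬ (compl l ∈ C)

Resolvent : Clause → Clause → Clause → Set
Resolvent E F R = ∃[ l ] ∃[ C ] ∃[ D ]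
  (E ≈C (l ∷ C) × F ≈C (compl l ∷ D) × NoComplPair (C ++ D) × R ≈C (C ++ D))

data DerivFrom : List Clause → List Clause → Set where
  done : ∀ {Γ} → DerivFrom Γ []
  step : ∀ {Γ E F R ψ} → E ∈ Γ → F ∈ Γ → Resolvent E F R
       → DerivFrom (Γ ++ [ R ]) ψ → DerivFrom Γ (R ∷ ψ)

_⊢res_ : CNF → CNF → Set
φ ⊢res ψ = DerivFrom φ ψ

InRes : ∀ {n} → OBDD n → Fin n → Fin n → CNF → CNF → Set
InRes B p h φ ψ = (φ ⊢res ψ) × ((φ ++ ψ) ⊴ eliminate B p h)

ClsAtMost : CNF → ℕ → Set
ClsAtMost ψ k = ∃[ reps ] (length reps Data.Nat.≤ k
                  × (∀ C → C ∈ ψ → ∃[ R ] (R ∈ reps × C ≈C R)))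

-- A false path through p reads β x γ or β ¬x γ, with the literal on x = var p
-- in the middle.  Since high(p) ≅ low(p), whenever one of these is a false path
-- so is the other, and eliminating p merges the pair into the false path β γ of
-- B′.  The clauses of φ falsified on β x γ and on β ¬x γ resolve on x to a
-- clause falsified on β γ, unless one of them already is; so one resolvent per
-- pair, i.e. per two paths through p, makes φ ∧ ψ refute every false path of
-- B′.  The resolvents are implied by φ, so φ ∧ ψ still has the false paths of
-- B′ as its falsifying assignments.

module Submission where

open import Defs
open import Data.Nat using (ℕ; _*_; _≤_; _<_; s≤s; z≤n)
import Data.Nat as ℕ
open import Data.Nat.Properties
  using (<-irrefl; <-trans; <⇒≢; >⇒≢; ≤-refl; ≤-trans; ≤-reflexive; +-identityʳ; *-monoʳ-≤)
open import Data.Bool using (Bool; true; false; not)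
open import Data.Bool.Properties using (not-involutive; not-¬; ¬-not) renaming (_≟_ to _≟ᵇ_)
open import Data.Fin using (Fin; _≟_)
open import Data.Maybe using (Maybe; just; nothing)
open import Data.List using (List; []; _∷_; _++_; length; filter; map; catMaybes)
open import Data.List.Properties
  using (length-++; length-map; length-catMaybes; map-++; map-id-local; map-injective;
         filter-++; filter-all; filter-reject)
open import Data.List.Relation.Unary.All as All using (All; []; _∷_)
open import Data.List.Relation.Unary.All.Properties using () renaming (++⁺ to All-++⁺)
open import Data.List.Relation.Unary.Any using (Any; here; there; any?)
open import Data.List.Relation.Unary.Any.Properties using (mapWith∈⁺; mapWith∈⁻)
import Data.List.Relation.Unary.AllPairs as AllPairs
open import Data.List.Relation.Unary.Unique.Propositional using (Unique)
import Data.List.Relation.Unary.Unique.Propositional.Properties as Unique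
open import Data.List.Membership.Propositional using (_∈_; _∉_; mapWith∈; find; lose)
open import Data.List.Membership.Propositional.Properties
  using (∈-++⁺ˡ; ∈-++⁺ʳ; ∈-++⁻; ∈-filter⁺; ∈-filter⁻; ∈-map⁻; ∈-∃++)
open import Data.List.Membership.DecPropositional using () renaming (_∈?_ to ∈?[_])
open import Data.List.Membership.Setoid.Properties using (length-mapWith∈)
open import Data.List.Relation.Binary.Subset.Propositional using (_⊆_)
open import Data.List.Relation.Binary.Subset.Propositional.Properties using (∷⁺ʳ; xs⊆x∷xs)
open import Data.List.Relation.Binary.Permutation.Propositional.Properties
  using (shift; ∈-resp-↭; ↭-length)
open import Data.Product using (Σ; ∃₂; ∃-syntax; _×_; _,_; proj₁; proj₂)
open import Data.Sum using (_⊎_; inj₁; inj₂)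
open import Function using (_∘_; Injective)
open import Level using (0ℓ)
open import Relation.Nullary using (¬_; Dec; yes; no; contradiction; ¬?)
open import Relation.Unary using (Pred; Decidable)
open import Relation.Binary.Definitions using (DecidableEquality)
open import Relation.Binary.PropositionalEquality
  using (_≡_; _≢_; refl; sym; trans; cong; subst; setoid)

_≟ˡ_ : DecidableEquality Literal
lit s y ≟ˡ lit s′ y′ with s ≟ᵇ s′ | y ℕ.≟ y′
... | yes refl | yes refl = yes refl
... | no s≢s′  | _        = no λ { refl → s≢s′ refl }
... | _        | no y≢y′  = no λ { refl → y≢y′ refl }

_∈ˡ?_ : (m : Literal) (α : List Literal) → Dec (m ∈ α)
_∈ˡ?_ = ∈?[ _≟ˡ_ ]

NoVar : ℕ → List Literal → Set
NoVar x = All (λ m → var m ≢ x)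

var≢⇒≢lit : ∀ {m x s} → var m ≢ x → m ≢ lit s x
var≢⇒≢lit var≢x refl = var≢x refl

_[_≔_] : Assignment → ℕ → Bool → Assignment
(a [ x ≔ b ]) y with y ℕ.≟ x
... | yes _ = b
... | no _  = a y

update-same : ∀ a x b → (a [ x ≔ b ]) x ≡ b
update-same a x b with x ℕ.≟ x
... | yes _   = refl
... | no x≢x = contradiction refl x≢x

SatLit-update : ∀ {a x} b {m} → m ≢ lit (not b) x → SatLit a m → SatLit (a [ x ≔ b ]) m
SatLit-update {x = x} b {lit s y} m≢¬b sm with y ℕ.≟ x
... | yes refl = sym (trans (¬-not λ s≡¬b → m≢¬b (cong (λ t → lit t x) s≡¬b)) (not-involutive b))
... | no _     = sm

SatLit-compl : ∀ {a} m → SatLit a m → ¬ SatLit a (compl m)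
SatLit-compl (lit s y) e₁ e₂ = not-¬ refl (trans (sym e₁) e₂)

SatLit-or-compl : ∀ a m → SatLit a m ⊎ SatLit a (compl m)
SatLit-or-compl a (lit s y) with a y ≟ᵇ s
... | yes e = inj₁ e
... | no e  = inj₂ (¬-not e)

insert⊆∷ : ∀ {A : Set} {m : A} β γ → β ++ m ∷ γ ⊆ m ∷ β ++ γ
insert⊆∷ β γ = ∈-resp-↭ (shift _ β γ)

SatAll-⊆ : ∀ {a α α′} → α ⊆ α′ → SatAll a α′ → SatAll a α
SatAll-⊆ α⊆α′ sa m m∈ = sa m (α⊆α′ m∈)

SatAll-∷ : ∀ {a m δ} → SatLit a m → SatAll a δ → SatAll a (m ∷ δ)
SatAll-∷ sm sa _ (here refl) = sm
SatAll-∷ sm sa m (there m∈) = sa m m∈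

SatAll-update : ∀ {a x δ} b → NoVar x δ → SatAll a δ → SatAll (a [ x ≔ b ]) (lit b x ∷ δ)
SatAll-update {a} {x} b nδ sa =
  SatAll-∷ (update-same a x b) λ m m∈ → SatLit-update b (var≢⇒≢lit (All.lookup nδ m∈)) (sa m m∈)

⊭-⊆ : ∀ {α α′ C} → α ⊆ α′ → α ⊭ C → α′ ⊭ C
⊭-⊆ α⊆α′ α⊭C a = α⊭C a ∘ SatAll-⊆ α⊆α′

⊭-++ : ∀ {δ} C {D} → δ ⊭ C → δ ⊭ D → δ ⊭ (C ++ D)
⊭-++ C δ⊭C δ⊭D a sa (m , m∈ , sm) with ∈-++⁻ C m∈
... | inj₁ m∈C = δ⊭C a sa (m , m∈C , sm)
... | inj₂ m∈D = δ⊭D a sa (m , m∈D , sm)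

⊭-complementary : ∀ {δ D C} → δ ⊭ D → Any (λ m → compl m ∈ D) D → δ ⊭ C
⊭-complementary δ⊭D comp a sa _ with find comp
... | m , m∈ , cm∈ with SatLit-or-compl a m
...   | inj₁ sm  = δ⊭D a sa (m , m∈ , sm)
...   | inj₂ scm = δ⊭D a sa (compl m , cm∈ , scm)

notVar? : ∀ x → Decidable (λ m → var m ≢ x)
notVar? x m = ¬? (var m ℕ.≟ x)

dropVar : ℕ → Clause → Clause
dropVar x = filter (notVar? x)

dropVar-insert : ∀ {x s} β γ → NoVar x β → NoVar x γ → dropVar x (β ++ lit s x ∷ γ) ≡ β ++ γ
dropVar-insert {x} {s} β γ nβ nγ
  rewrite filter-++ (notVar? x) β (lit s x ∷ γ)
        | filter-all (notVar? x) nβ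
        | filter-reject (notVar? x) {lit s x} {γ} (λ x≢x → x≢x refl)
        | filter-all (notVar? x) nγ = refl

dropVar-≈C : ∀ {x b C} → lit b x ∈ C → lit (not b) x ∉ C → C ≈C (lit b x ∷ dropVar x C)
dropVar-≈C {x} {b} {C} x∈C ¬x∉C = to , from
  where
  to : ∀ m → m ∈ C → m ∈ lit b x ∷ dropVar x C
  to (lit s y) m∈ with y ℕ.≟ x
  ... | no y≢x   = there (∈-filter⁺ (notVar? x) m∈ y≢x)
  ... | yes refl with s ≟ᵇ b
  ...   | yes refl = here refl
  ...   | no s≢b   = contradiction (subst (λ t → lit t x ∈ C) (¬-not s≢b) m∈) ¬x∉C
  from : ∀ m → m ∈ lit b x ∷ dropVar x C → m ∈ C
  from m (here refl) = x∈C
  from m (there m∈)  = proj₁ (∈-filter⁻ (notVar? x) {xs = C} m∈)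

⊭-dropVar : ∀ {x b δ C} → NoVar x δ → (lit b x ∷ δ) ⊭ C → δ ⊭ dropVar x C
⊭-dropVar {x} {b} {C = C} nδ r a sa (m , m∈ , sm) =
  r (a [ x ≔ b ]) (SatAll-update b nδ sa) (m , m∈C , SatLit-update b (var≢⇒≢lit m≢x) sm)
  where
  m∈C = proj₁ (∈-filter⁻ (notVar? x) {xs = C} m∈)
  m≢x = proj₂ (∈-filter⁻ (notVar? x) {xs = C} m∈)

⊭-resolvent-on : ∀ {x δ C₁ C₂} → NoVar x δ
               → (lit true x ∷ δ) ⊭ C₁ → (lit false x ∷ δ) ⊭ C₂
               → δ ⊭ (dropVar x C₁ ++ dropVar x C₂)
⊭-resolvent-on {x} {C₁ = C₁} nδ r₁ r₂ =
  ⊭-++ (dropVar x C₁) (⊭-dropVar nδ r₁) (⊭-dropVar nδ r₂)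

⊭-dropLit : ∀ {x b δ C} → NoVar x δ → (lit b x ∷ δ) ⊭ C
          → lit b x ∈ C ⊎ lit (not b) x ∉ C → δ ⊭ C
⊭-dropLit {x} {b} nδ r side a sa (m , m∈ , sm) with side
... | inj₁ x∈C  = r (a [ x ≔ b ]) (SatAll-update b nδ sa) (lit b x , x∈C , update-same a x b)
... | inj₂ ¬x∉C = r (a [ x ≔ b ]) (SatAll-update b nδ sa)
                    (m , m∈ , SatLit-update {a} {x} b (λ { refl → ¬x∉C m∈ }) sm)

≈C-refl : ∀ {C} → C ≈C C
≈C-refl = (λ _ m∈ → m∈) , (λ _ m∈ → m∈)

resolvent-on : ∀ {x C₁ C₂} → lit false x ∈ C₁ → lit true x ∉ C₁
             → lit true x ∈ C₂ → lit false x ∉ C₂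
             → NoComplPair (dropVar x C₁ ++ dropVar x C₂)
             → Resolvent C₁ C₂ (dropVar x C₁ ++ dropVar x C₂)
resolvent-on {x} ¬x∈C₁ x∉C₁ x∈C₂ ¬x∉C₂ nc =
  lit false x , _ , _ , dropVar-≈C ¬x∈C₁ x∉C₁ , dropVar-≈C x∈C₂ ¬x∉C₂ , nc , ≈C-refl

-- C₁ itself is falsified on δ when it lacks ¬x, or when δ is unsatisfiable
-- (C₁ contains x, or the resolvent is a tautology); symmetrically for C₂;
-- otherwise the resolvent on x is.
resolve-on : ∀ {x δ C₁ C₂} → NoVar x δ → (lit true x ∷ δ) ⊭ C₁ → (lit false x ∷ δ) ⊭ C₂
           → δ ⊭ C₁ ⊎ δ ⊭ C₂ ⊎ ∃[ R ] (Resolvent C₁ C₂ R × δ ⊭ R)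
resolve-on {x} {δ} {C₁} {C₂} nδ r₁ r₂
  with lit true x ∈ˡ? C₁ | lit false x ∈ˡ? C₁ | lit true x ∈ˡ? C₂ | lit false x ∈ˡ? C₂
... | yes x∈C₁ | _         | _        | _          = inj₁ (⊭-dropLit nδ r₁ (inj₁ x∈C₁))
... | _        | no ¬x∉C₁  | _        | _          = inj₁ (⊭-dropLit nδ r₁ (inj₂ ¬x∉C₁))
... | _        | _         | _        | yes ¬x∈C₂  = inj₂ (inj₁ (⊭-dropLit nδ r₂ (inj₁ ¬x∈C₂)))
... | _        | _         | no x∉C₂  | _          = inj₂ (inj₁ (⊭-dropLit nδ r₂ (inj₂ x∉C₂)))
... | no x∉C₁  | yes ¬x∈C₁ | yes x∈C₂ | no ¬x∉C₂
  with any? (λ m → compl m ∈ˡ? (dropVar x C₁ ++ dropVar x C₂)) (dropVar x C₁ ++ dropVar x C₂)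
...   | yes comp = inj₁ (⊭-complementary (⊭-resolvent-on nδ r₁ r₂) comp)
...   | no ¬comp =
  inj₂ (inj₂ (_ , resolvent-on ¬x∈C₁ x∉C₁ x∈C₂ ¬x∉C₂ (λ _ m∈ cm∈ → ¬comp (lose m∈ cm∈))
              , ⊭-resolvent-on nδ r₁ r₂))

¬SatClause-∷ : ∀ {a k K} → ¬ SatLit a k → ¬ SatClause a K → ¬ SatClause a (k ∷ K)
¬SatClause-∷ ¬k ¬K (m , here refl , sm) = ¬k sm
¬SatClause-∷ ¬k ¬K (m , there m∈ , sm) = ¬K (m , m∈ , sm)

¬SatClause-⊆ : ∀ {a C D} → (∀ m → m ∈ C → m ∈ D) → ¬ SatClause a D → ¬ SatClause a C
¬SatClause-⊆ C⊆D ¬D (m , m∈ , sm) = ¬D (m , C⊆D m m∈ , sm)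

resolvent-sound : ∀ {E F R} a → Resolvent E F R
                → ¬ SatClause a R → ¬ SatClause a E ⊎ ¬ SatClause a F
resolvent-sound a (l , C , D , (E⊆ , _) , (F⊆ , _) , _ , (_ , C++D⊆R)) ¬R with SatLit-or-compl a l
... | inj₁ sl  = inj₂ (¬SatClause-⊆ F⊆ (¬SatClause-∷ (SatLit-compl {a} l sl)
                   (¬SatClause-⊆ (λ m → C++D⊆R m ∘ ∈-++⁺ʳ C) ¬R)))
... | inj₂ scl = inj₁ (¬SatClause-⊆ E⊆ (¬SatClause-∷ (λ sl → SatLit-compl {a} l sl scl)
                   (¬SatClause-⊆ (λ m → C++D⊆R m ∘ ∈-++⁺ˡ) ¬R)))

ResolventOf : CNF → Clause → Set
ResolventOf φ R = ∃[ E ] ∃[ F ] (E ∈ φ × F ∈ φ × Resolvent E F R)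

DerivFrom-resolvents : ∀ {φ Γ ψ} → φ ⊆ Γ → (∀ {R} → R ∈ ψ → ResolventOf φ R) → DerivFrom Γ ψ
DerivFrom-resolvents {ψ = []} φ⊆Γ res = done
DerivFrom-resolvents {ψ = R ∷ ψ} φ⊆Γ res with res (here refl)
... | E , F , E∈φ , F∈φ , r =
  step (φ⊆Γ E∈φ) (φ⊆Γ F∈φ) r (DerivFrom-resolvents (∈-++⁺ˡ ∘ φ⊆Γ) (res ∘ there))

ClsAtMost-length : ∀ ψ → ClsAtMost ψ (length ψ)
ClsAtMost-length ψ = ψ , ≤-refl , λ C C∈ψ → C , C∈ψ , ≈C-refl

length-≤-⊆ : ∀ {A : Set} {xs ys : List A} → Unique xs → xs ⊆ ys → length xs ≤ length ys
length-≤-⊆ {xs = []} _ _ = z≤n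
length-≤-⊆ {xs = v ∷ xs} (v∉xs AllPairs.∷ u) v∷xs⊆ys with ∈-∃++ (v∷xs⊆ys (here refl))
... | ys₁ , ys₂ , refl =
  ≤-trans (s≤s (length-≤-⊆ u xs⊆)) (≤-reflexive (sym (↭-length (shift v ys₁ ys₂))))
  where
  xs⊆ : xs ⊆ ys₁ ++ ys₂
  xs⊆ z∈xs with ∈-resp-↭ (shift v ys₁ ys₂) (v∷xs⊆ys (there z∈xs))
  ... | here refl = contradiction refl (All.lookup v∉xs z∈xs)
  ... | there z∈  = z∈

filter-twins-≤ : ∀ {A : Set} {P : Pred A 0ℓ} (P? : Decidable P) {g : A → A} {L : List A}
               → Unique L → Injective _≡_ _≡_ g
               → (∀ {α} → α ∈ L → P α → g α ∈ L × ¬ P (g α))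
               → 2 * length (filter P? L) ≤ length L
filter-twins-≤ {P = P} P? {g} {L} uL g-inj twin =
  subst (_≤ length L) length-H++gH (length-≤-⊆ unique H++gH⊆L)
  where
  H = filter P? L
  twinᴴ : ∀ {α} → α ∈ H → g α ∈ L × ¬ P (g α)
  twinᴴ α∈H = twin (proj₁ (∈-filter⁻ P? {xs = L} α∈H)) (proj₂ (∈-filter⁻ P? {xs = L} α∈H))
  uH = Unique.filter⁺ P? uL
  disjoint : ∀ {v} → ¬ (v ∈ H × v ∈ map g H)
  disjoint (v∈H , v∈gH) with ∈-map⁻ g v∈gH
  ... | α , α∈H , refl = proj₂ (twinᴴ α∈H) (proj₂ (∈-filter⁻ P? {xs = L} v∈H))
  unique : Unique (H ++ map g H)
  unique = Unique.++⁺ uH (Unique.map⁺ g-inj uH) disjoint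
  H++gH⊆L : H ++ map g H ⊆ L
  H++gH⊆L v∈ with ∈-++⁻ H v∈
  ... | inj₁ v∈H = proj₁ (∈-filter⁻ P? {xs = L} v∈H)
  ... | inj₂ v∈gH with ∈-map⁻ g v∈gH
  ...   | α , α∈H , refl = proj₁ (twinᴴ α∈H)
  length-H++gH : length (H ++ map g H) ≡ 2 * length H
  length-H++gH rewrite length-++ H {map g H} | length-map g H | +-identityʳ (length H) = refl

flipAt : ℕ → Literal → Literal
flipAt x m with var m ℕ.≟ x
... | yes _ = compl m
... | no _  = m

flipAt-other : ∀ {x m} → var m ≢ x → flipAt x m ≡ m
flipAt-other {x} {m} m≢x with var m ℕ.≟ x
... | yes m≡x = contradiction m≡x m≢x
... | no _    = refl

flipAt-x : ∀ {x} s → flipAt x (lit s x) ≡ lit (not s) x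
flipAt-x {x} s with x ℕ.≟ x
... | yes _   = refl
... | no x≢x = contradiction refl x≢x

flipAt-involutive : ∀ x m → flipAt x (flipAt x m) ≡ m
flipAt-involutive x (lit s y) with y ℕ.≟ x
... | yes refl = trans (flipAt-x (not s)) (cong (λ t → lit t x) (not-involutive s))
... | no y≢x   = flipAt-other y≢x

map-flipAt-injective : ∀ x → Injective _≡_ _≡_ (map (flipAt x))
map-flipAt-injective x = map-injective λ {m} {m′} e →
  trans (sym (flipAt-involutive x m)) (trans (cong (flipAt x) e) (flipAt-involutive x m′))

map-flipAt-insert : ∀ {x s} β γ → NoVar x β → NoVar x γ
                  → map (flipAt x) (β ++ lit s x ∷ γ) ≡ β ++ lit (not s) x ∷ γ
map-flipAt-insert {x} {s} β γ nβ nγ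
  rewrite map-++ (flipAt x) β (lit s x ∷ γ)
        | map-id-local (All.map flipAt-other nβ)
        | flipAt-x {x} s
        | map-id-local (All.map flipAt-other nγ) = refl

x-literal-unique : ∀ {x s s′} β γ → NoVar x β → NoVar x γ
                 → lit s′ x ∈ β ++ lit s x ∷ γ → s′ ≡ s
x-literal-unique β γ nβ nγ m∈ with ∈-++⁻ β m∈
... | inj₁ m∈β         = contradiction refl (All.lookup nβ m∈β)
... | inj₂ (here refl) = refl
... | inj₂ (there m∈γ) = contradiction refl (All.lookup nγ m∈γ)

Iso-sym : ∀ {n} {B : OBDD n} {i j} → Iso B i j → Iso B j i
Iso-sym (isoLeaf ei ej)        = isoLeaf ej ei
Iso-sym (isoInner ei ej ih il) = isoInner ej ei (Iso-sym ih) (Iso-sym il)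

Iso-transport : ∀ {n} {B : OBDD n} {i j γ} → Iso B i j → FWalk B i γ → FWalk B j γ
Iso-transport (isoLeaf ei ej) (fleaf e) with trans (sym ei) e
... | refl = fleaf ej
Iso-transport (isoLeaf ei ej) (fhi e w) = contradiction (trans (sym ei) e) λ ()
Iso-transport (isoLeaf ei ej) (flo e w) = contradiction (trans (sym ei) e) λ ()
Iso-transport (isoInner ei ej ih il) (fleaf e) = contradiction (trans (sym ei) e) λ ()
Iso-transport (isoInner ei ej ih il) (fhi e w) with trans (sym ei) e
... | refl = fhi ej (Iso-transport ih w)
Iso-transport (isoInner ei ej ih il) (flo e w) with trans (sym ei) e
... | refl = flo ej (Iso-transport il w)

OrderedEdge-weaken : ∀ {n} {B : OBDD n} {b c k} → b < c → OrderedEdge B c k → OrderedEdge B b k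
OrderedEdge-weaken b<c oe y h l e = <-trans b<c (oe y h l e)

module Ordered {n} {B : OBDD n} (wf : WellFormed B) where

  hi-ordered : ∀ {i y hi lo} → node B i ≡ inner y hi lo → OrderedEdge B y hi
  hi-ordered e = proj₁ (proj₁ wf _ _ _ _ e)

  lo-ordered : ∀ {i y hi lo} → node B i ≡ inner y hi lo → OrderedEdge B y lo
  lo-ordered e = proj₂ (proj₁ wf _ _ _ _ e)

  OrderedEdge-hi : ∀ {b k y hi lo} → OrderedEdge B b k → node B k ≡ inner y hi lo → OrderedEdge B b hi
  OrderedEdge-hi oe e = OrderedEdge-weaken {B = B} (oe _ _ _ e) (hi-ordered e)

  OrderedEdge-lo : ∀ {b k y hi lo} → OrderedEdge B b k → node B k ≡ inner y hi lo → OrderedEdge B b lo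
  OrderedEdge-lo oe e = OrderedEdge-weaken {B = B} (oe _ _ _ e) (lo-ordered e)

  walk-vars-above : ∀ {b k γ} → OrderedEdge B b k → FWalk B k γ → All (λ m → b < var m) γ
  walk-vars-above oe (fleaf e)  = []
  walk-vars-above oe (fhi e w) = oe _ _ _ e ∷ walk-vars-above (OrderedEdge-hi oe e) w
  walk-vars-above oe (flo e w) = oe _ _ _ e ∷ walk-vars-above (OrderedEdge-lo oe e) w

  visit-below : ∀ {p x hp lp b k α} → node B p ≡ inner x hp lp
              → OrderedEdge B b k → (w : FWalk B k α) → Visits p w → b < x
  visit-below node-p oe (fleaf e) refl         = contradiction (trans (sym e) node-p) λ ()
  visit-below node-p oe (fhi e w) (inj₁ refl) = oe _ _ _ node-p
  visit-below node-p oe (flo e w) (inj₁ refl) = oe _ _ _ node-p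
  visit-below node-p oe (fhi e w) (inj₂ v)    = visit-below node-p (OrderedEdge-hi oe e) w v
  visit-below node-p oe (flo e w) (inj₂ v)    = visit-below node-p (OrderedEdge-lo oe e) w v

redirect-other : ∀ {n} {p k : Fin n} h → k ≢ p → redirect p h k ≡ k
redirect-other {p = p} {k} h k≢p with k ≟ p
... | yes k≡p = contradiction k≡p k≢p
... | no _    = refl

redirectNode-leaf : ∀ {n} {p h : Fin n} {nd b} → redirectNode p h nd ≡ leaf b → nd ≡ leaf b
redirectNode-leaf {nd = leaf _} refl = refl

redirectNode-inner : ∀ {n} {p h : Fin n} {nd y h′ l′} → redirectNode p h nd ≡ inner y h′ l′
                   → ∃₂ λ hi lo → nd ≡ inner y hi lo × h′ ≡ redirect p h hi × l′ ≡ redirect p h lo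
redirectNode-inner {nd = inner _ hi lo} refl = hi , lo , refl , refl , refl

module Elimination {n} {B : OBDD n} (wf : WellFormed B) {p h l : Fin n} {x : ℕ}
                   (node-p : node B p ≡ inner x h l) (iso : Iso B h l) where

  open Ordered wf

  B′ : OBDD n
  B′ = eliminate B p h

  PathThrough : Fin n → List Literal → Set
  PathThrough k α = Σ (FWalk B k α) (Visits p)

  Twins : Fin n → List Literal → List Literal → Set
  Twins k β γ = NoVar x β × NoVar x γ × (∀ s → PathThrough k (β ++ lit s x ∷ γ))

  ordered-h : OrderedEdge B x h
  ordered-h = hi-ordered node-p

  ordered-x⇒≢p : ∀ {k} → OrderedEdge B x k → k ≢ p
  ordered-x⇒≢p oe refl = <-irrefl refl (oe x h l node-p)

  twins-at-p : ∀ {γ} → FWalk B h γ → Twins p [] γ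
  twins-at-p w = [] , All.map >⇒≢ (walk-vars-above ordered-h w) , through
    where
    through : ∀ s → PathThrough p (lit s x ∷ _)
    through true  = fhi node-p w , inj₁ refl
    through false = flo node-p (Iso-transport iso w) , inj₁ refl

  twins-hi : ∀ {k y hi lo β γ} → node B k ≡ inner y hi lo
           → Twins hi β γ → Twins k (lit true y ∷ β) γ
  twins-hi e (nβ , nγ , through) =
    <⇒≢ (visit-below node-p (hi-ordered e) (proj₁ (through true)) (proj₂ (through true))) ∷ nβ , nγ ,
    λ s → fhi e (proj₁ (through s)) , inj₂ (proj₂ (through s))

  twins-lo : ∀ {k y hi lo β γ} → node B k ≡ inner y hi lo
           → Twins lo β γ → Twins k (lit false y ∷ β) γ
  twins-lo e (nβ , nγ , through) =
    <⇒≢ (visit-below node-p (lo-ordered e) (proj₁ (through true)) (proj₂ (through true))) ∷ nβ , nγ ,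
    λ s → flo e (proj₁ (through s)) , inj₂ (proj₂ (through s))

  through-twins : ∀ {k α} (w : FWalk B k α) → Visits p w
                → ∃[ β ] ∃[ s ] ∃[ γ ] (α ≡ β ++ lit s x ∷ γ × Twins k β γ)
  through-twins (fleaf e) refl = contradiction (trans (sym e) node-p) λ ()
  through-twins (fhi e w) (inj₁ refl) with trans (sym node-p) e
  ... | refl = [] , true , _ , refl , twins-at-p w
  through-twins (flo e w) (inj₁ refl) with trans (sym node-p) e
  ... | refl = [] , false , _ , refl , twins-at-p (Iso-transport (Iso-sym iso) w)
  through-twins (fhi e w) (inj₂ v) with through-twins w v
  ... | β , s , γ , refl , tw = _ ∷ β , s , γ , refl , twins-hi e tw
  through-twins (flo e w) (inj₂ v) with through-twins w v
  ... | β , s , γ , refl , tw = _ ∷ β , s , γ , refl , twins-lo e tw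

  below-x⇒B′ : ∀ {k γ} → OrderedEdge B x k → FWalk B k γ → FWalk B′ k γ
  below-x⇒B′ oe (fleaf e) = fleaf (cong (redirectNode p h) e)
  below-x⇒B′ oe (fhi e w) =
    fhi (cong (redirectNode p h) e)
        (subst (λ c → FWalk B′ c _) (sym (redirect-other h (ordered-x⇒≢p (OrderedEdge-hi oe e))))
               (below-x⇒B′ (OrderedEdge-hi oe e) w))
  below-x⇒B′ oe (flo e w) =
    flo (cong (redirectNode p h) e)
        (subst (λ c → FWalk B′ c _) (sym (redirect-other h (ordered-x⇒≢p (OrderedEdge-lo oe e))))
               (below-x⇒B′ (OrderedEdge-lo oe e) w))

  B′⇒below-x : ∀ {k k′ γ} → OrderedEdge B x k → k′ ≡ k → FWalk B′ k′ γ → FWalk B k γ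
  B′⇒below-x oe refl (fleaf e) = fleaf (redirectNode-leaf e)
  B′⇒below-x oe refl (fhi e w) with redirectNode-inner e
  ... | hi , lo , eB , refl , refl =
    fhi eB (B′⇒below-x oe′ (redirect-other h (ordered-x⇒≢p oe′)) w)
    where oe′ = OrderedEdge-hi oe eB
  B′⇒below-x oe refl (flo e w) with redirectNode-inner e
  ... | hi , lo , eB , refl , refl =
    flo eB (B′⇒below-x oe′ (redirect-other h (ordered-x⇒≢p oe′)) w)
    where oe′ = OrderedEdge-lo oe eB

  -- Matching on k ≟ p also reduces redirect p h k in the goal.
  B′-subwalk : ∀ {k α} → FWalk B k α → ∃[ δ ] (FWalk B′ (redirect p h k) δ × δ ⊆ α)
  B′-subwalk {k} (fleaf e) with k ≟ p
  ... | yes refl = contradiction (trans (sym e) node-p) λ ()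
  ... | no _     = [] , fleaf (cong (redirectNode p h) e) , λ ()
  B′-subwalk {k} (fhi e w) with k ≟ p
  ... | yes refl with trans (sym node-p) e
  ...   | refl = _ , below-x⇒B′ ordered-h w , xs⊆x∷xs _ _
  B′-subwalk {k} (fhi e w) | no _ with B′-subwalk w
  ... | δ , w′ , δ⊆α = _ , fhi (cong (redirectNode p h) e) w′ , ∷⁺ʳ _ δ⊆α
  B′-subwalk {k} (flo e w) with k ≟ p
  ... | yes refl with trans (sym node-p) e
  ...   | refl = _ , below-x⇒B′ ordered-h (Iso-transport (Iso-sym iso) w) , xs⊆x∷xs _ _
  B′-subwalk {k} (flo e w) | no _ with B′-subwalk w
  ... | δ , w′ , δ⊆α = _ , flo (cong (redirectNode p h) e) w′ , ∷⁺ʳ _ δ⊆α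

  B′-walk-cases : ∀ k {k′ δ} → k′ ≡ redirect p h k → FWalk B′ k′ δ
                → FWalk B k δ ⊎ ∃₂ (λ β γ → δ ≡ β ++ γ × Twins k β γ)
  B′-walk-cases-from : ∀ {k k′ δ} → k′ ≡ k → FWalk B′ k′ δ
                     → FWalk B k δ ⊎ ∃₂ (λ β γ → δ ≡ β ++ γ × Twins k β γ)

  B′-walk-cases k eq w with k ≟ p
  ... | yes refl = inj₂ ([] , _ , refl , twins-at-p (B′⇒below-x ordered-h eq w))
  ... | no _     = B′-walk-cases-from eq w

  B′-walk-cases-from refl (fleaf e) = inj₁ (fleaf (redirectNode-leaf e))
  B′-walk-cases-from refl (fhi e w) with redirectNode-inner e
  ... | hi , lo , eB , refl , refl with B′-walk-cases hi refl w
  ...   | inj₁ wB                  = inj₁ (fhi eB wB)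
  ...   | inj₂ (β , γ , refl , tw) = inj₂ (_ ∷ β , γ , refl , twins-hi eB tw)
  B′-walk-cases-from refl (flo e w) with redirectNode-inner e
  ... | hi , lo , eB , refl , refl with B′-walk-cases lo refl w
  ...   | inj₁ wB                  = inj₁ (flo eB wB)
  ...   | inj₂ (β , γ , refl , tw) = inj₂ (_ ∷ β , γ , refl , twins-lo eB tw)

Refutes : CNF → List Literal → Set
Refutes φ δ = ∃[ C ] (C ∈ φ × δ ⊭ C)

ResolventRefutes : CNF → List Literal → Set
ResolventRefutes φ δ = ∃[ R ] (ResolventOf φ R × δ ⊭ R)

Refutes-++ˡ : ∀ {φ δ} ψ → Refutes φ δ → Refutes (φ ++ ψ) δ
Refutes-++ˡ ψ (C , C∈φ , r) = C , ∈-++⁺ˡ C∈φ , r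

resolventOf : ∀ {φ δ} → Refutes φ δ ⊎ ResolventRefutes φ δ → Maybe Clause
resolventOf (inj₁ _)           = nothing
resolventOf (inj₂ (R , _ , _)) = just R

resolventOf-sound : ∀ {φ δ R} (r : Refutes φ δ ⊎ ResolventRefutes φ δ)
                  → just R ≡ resolventOf r → ResolventOf φ R
resolventOf-sound (inj₂ (_ , res , _)) refl = res

∈-catMaybes⁺ : ∀ {A : Set} {v : A} {ms} → just v ∈ ms → v ∈ catMaybes ms
∈-catMaybes⁺ {ms = just _ ∷ ms}  (here refl) = here refl
∈-catMaybes⁺ {ms = just _ ∷ ms}  (there v∈) = there (∈-catMaybes⁺ v∈)
∈-catMaybes⁺ {ms = nothing ∷ ms} (there v∈) = ∈-catMaybes⁺ v∈

∈-catMaybes⁻ : ∀ {A : Set} {v : A} ms → v ∈ catMaybes ms → just v ∈ ms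
∈-catMaybes⁻ (just _ ∷ ms)  (here refl) = here refl
∈-catMaybes⁻ (just _ ∷ ms)  (there v∈) = there (∈-catMaybes⁻ ms v∈)
∈-catMaybes⁻ (nothing ∷ ms) v∈         = there (∈-catMaybes⁻ ms v∈)

module MergedResolvents
  {n} (φ : CNF) {B : OBDD n} (wf : WellFormed B)
  (sem : ∀ a → (FalsifiesCNF a φ → ∃[ α ] (PathF B α × SatAll a α))
             × (∃[ α ] (PathF B α × SatAll a α) → FalsifiesCNF a φ))
  (refute : ∀ α → PathF B α → Refutes φ α)
  {p h l : Fin n} {x : ℕ} (node-p : node B p ≡ inner x h l) (iso : Iso B h l)
  {L : List (List Literal)} (uL : Unique L)
  (L-paths : ∀ α → (α ∈ L → PathFThrough B p α) × (PathFThrough B p α → α ∈ L)) where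

  open Elimination wf node-p iso

  path-twins : ∀ {α} → α ∈ L
             → ∃[ β ] ∃[ s ] ∃[ γ ] (α ≡ β ++ lit s x ∷ γ × Twins (root B) β γ)
  path-twins α∈L = through-twins (proj₁ path) (proj₂ path)
    where path = proj₁ (L-paths _) α∈L

  twins-refutation : ∀ {β γ} → Twins (root B) β γ
                   → Refutes φ (β ++ γ) ⊎ ResolventRefutes φ (β ++ γ)
  twins-refutation {β} {γ} (nβ , nγ , through)
    with refute _ (proj₁ (through true)) | refute _ (proj₁ (through false))
  ... | C₁ , C₁∈φ , r₁ | C₂ , C₂∈φ , r₂
    with resolve-on (All-++⁺ nβ nγ) (⊭-⊆ (insert⊆∷ β γ) r₁) (⊭-⊆ (insert⊆∷ β γ) r₂)
  ... | inj₁ δ⊭C₁                 = inj₁ (C₁ , C₁∈φ , δ⊭C₁)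
  ... | inj₂ (inj₁ δ⊭C₂)          = inj₁ (C₂ , C₂∈φ , δ⊭C₂)
  ... | inj₂ (inj₂ (R , res , δ⊭R)) = inj₂ (R , (C₁ , C₂ , C₁∈φ , C₂∈φ , res) , δ⊭R)

  merged-refutation : ∀ {α} → α ∈ L → Refutes φ (dropVar x α) ⊎ ResolventRefutes φ (dropVar x α)
  merged-refutation α∈L with path-twins α∈L
  ... | β , s , γ , refl , tw@(nβ , nγ , _)
    rewrite dropVar-insert {x} {s} β γ nβ nγ = twins-refutation tw

  -- Only positive paths contribute, so that each twin pair is counted once.
  H : List (List Literal)
  H = filter (lit true x ∈ˡ?_) L

  H⊆L : H ⊆ L
  H⊆L = proj₁ ∘ ∈-filter⁻ (lit true x ∈ˡ?_) {xs = L}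

  resolvents : List (Maybe Clause)
  resolvents = mapWith∈ H (resolventOf ∘ merged-refutation ∘ H⊆L)

  ψ : CNF
  ψ = catMaybes resolvents

  ψ-resolvents : ∀ {R} → R ∈ ψ → ResolventOf φ R
  ψ-resolvents R∈ψ
    with mapWith∈⁻ H (resolventOf ∘ merged-refutation ∘ H⊆L) (∈-catMaybes⁻ resolvents R∈ψ)
  ... | _ , α∈H , R≡ = resolventOf-sound (merged-refutation (H⊆L α∈H)) R≡

  flip-twin : ∀ {α} → α ∈ L → lit true x ∈ α
            → map (flipAt x) α ∈ L × lit true x ∉ map (flipAt x) α
  flip-twin α∈L x∈α with path-twins α∈L
  ... | β , s , γ , refl , (nβ , nγ , through) rewrite map-flipAt-insert {x} {s} β γ nβ nγ =
    proj₂ (L-paths _) (through (not s)) ,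
    λ x∈ → not-¬ refl (trans (sym (x-literal-unique β γ nβ nγ x∈α)) (x-literal-unique β γ nβ nγ x∈))

  ψ-count : 2 * length ψ ≤ length L
  ψ-count = ≤-trans (*-monoʳ-≤ 2 ψ≤H)
                    (filter-twins-≤ (lit true x ∈ˡ?_) uL (map-flipAt-injective x) flip-twin)
    where
    ψ≤H : length ψ ≤ length H
    ψ≤H = ≤-trans (length-catMaybes resolvents) (≤-reflexive (length-mapWith∈ (setoid _) H))

  refuted-positive : ∀ {α} (α∈H : α ∈ H) → Refutes (φ ++ ψ) (dropVar x α)
  refuted-positive α∈H with merged-refutation (H⊆L α∈H) in eq
  ... | inj₁ refutes    = Refutes-++ˡ ψ refutes
  ... | inj₂ (R , _ , r) =
    R , ∈-++⁺ʳ φ (∈-catMaybes⁺ (mapWith∈⁺ _ (_ , α∈H , cong resolventOf (sym eq)))) , r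

  falsifies-φ : ∀ {a} → FalsifiesCNF a (φ ++ ψ) → FalsifiesCNF a φ
  falsifies-φ {a} (C , C∈ , ¬C) with ∈-++⁻ φ C∈
  ... | inj₁ C∈φ = C , C∈φ , ¬C
  ... | inj₂ C∈ψ with ψ-resolvents C∈ψ
  ...   | E , F , E∈φ , F∈φ , r with resolvent-sound a r ¬C
  ...     | inj₁ ¬E = E , E∈φ , ¬E
  ...     | inj₂ ¬F = F , F∈φ , ¬F

  falsifies-φ++ψ : ∀ {a} → FalsifiesCNF a φ → FalsifiesCNF a (φ ++ ψ)
  falsifies-φ++ψ (C , C∈φ , ¬C) = C , ∈-++⁺ˡ C∈φ , ¬C

  falsified⇒path : ∀ a → FalsifiesCNF a (φ ++ ψ) → ∃[ δ ] (PathF B′ δ × SatAll a δ)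
  falsified⇒path a fa with proj₁ (sem a) (falsifies-φ fa)
  ... | α , w , sa with B′-subwalk w
  ...   | δ , w′ , δ⊆α = δ , w′ , SatAll-⊆ δ⊆α sa

  path⇒falsified : ∀ a → ∃[ δ ] (PathF B′ δ × SatAll a δ) → FalsifiesCNF a (φ ++ ψ)
  path⇒falsified a (δ , w , sa) with B′-walk-cases (root B) refl w
  ... | inj₁ wB = falsifies-φ++ψ (proj₂ (sem a) (δ , wB , sa))
  ... | inj₂ (β , γ , refl , (_ , _ , through)) =
    falsifies-φ++ψ (proj₂ (sem a)
      (_ , proj₁ (through (a x)) , SatAll-⊆ (insert⊆∷ β γ) (SatAll-∷ refl sa)))

  refuted : ∀ δ → PathF B′ δ → Refutes (φ ++ ψ) δ
  refuted δ w with B′-walk-cases (root B) refl w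
  ... | inj₁ wB = Refutes-++ˡ ψ (refute δ wB)
  ... | inj₂ (β , γ , refl , (nβ , nγ , through)) =
    subst (Refutes (φ ++ ψ)) (dropVar-insert β γ nβ nγ) (refuted-positive α∈H)
    where
    α∈H : β ++ lit true x ∷ γ ∈ H
    α∈H = ∈-filter⁺ (lit true x ∈ˡ?_) (proj₂ (L-paths _) (through true)) (∈-++⁺ʳ β (here refl))

  φ++ψ⊴B′ : (φ ++ ψ) ⊴ B′
  φ++ψ⊴B′ = (λ a → falsified⇒path a , path⇒falsified a) , refuted

lemma5 : ∀ {n} (φ : CNF) (B : OBDD n) → WellFormed B → φ ⊴ B
       → (p h l : Fin n) (x : ℕ) → node B p ≡ inner x h l → Iso B h l
       → (N : ℕ) → HasCard (PathFThrough B p) N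
       → ∃[ ψ ] (InRes B p h φ ψ × ∃[ k ] (ClsAtMost ψ k × 2 * k ≤ N))
lemma5 φ B wf (sem , refute) p h l x node-p iso N (L , uL , L-paths , |L|≡N) =
  ψ , (DerivFrom-resolvents (λ C∈φ → C∈φ) ψ-resolvents , φ++ψ⊴B′) ,
  length ψ , ClsAtMost-length ψ , subst (2 * length ψ ≤_) |L|≡N ψ-count
  where open MergedResolvents φ wf sem refute node-p iso uL L-paths
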